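{- Let $D=(F,R,>)$ be a defeasible theory. Then every point of the graph $U(D)$ has out-degree at least $1$ in $U(D)$.
   Context: Literals are atoms $p$ or negated atoms $\neg p$; for a literal $q$, $\sim q$ is its complement. A defeasible theory $D=(F,R,>)$ consists of a finite set $F$ of literals (facts), a finite set $R$ of propositional rules, and a binary relation $>$ on $R$ whose transitive closure is irreflexive. Each rule $r$ has a unique label, an antecedent $A(r)$ (finite set of literals), a head $C(r)$ (a literal) and a kind: strict ($\to$), defeasible ($\Rightarrow$) or defeater ($\leadsto$). $R_s$: strict rules; $R_{sd}$: strict or defeasible rules; $R[q]$, $R_s[q]$, $R_{sd}[q]$: those with head $q$. A derivation in $D$ is a finite sequence $P(1),\dots,P(n)$ of tagged literals $+\Delta q,-\Delta q,+\partial q,-\partial q$ such that for each $i$ (with $P(1..i)$ the initial segment of length $i$): ($+\Delta$) if $P(i+1)=+\Delta q$ then $q\in F$ or $\exists r\in R_s[q]\,\forall a\in A(r):+\Delta a\in P(1..i)$; ($-\Delta$) if $P(i+1)=-\Delta q$ then $q\notin F$ and $\forall r\in R_s[q]\,\exists a\in A(r): -\Delta a\in P(1..i)$; ($+\partial$) if $P(i+1)=+\partial q$ then either $+\Delta q\in P(1..i)$, or: $\exists r\in R_{sd}[q]\,\forall a\in A(r):+\partial a\in P(1..i)$, and $-\Delta\sim q\in P(1..i)$, and for every $s\in R[\sim q]$ either $\exists a\in A(s):-\partial a\in P(1..i)$ or $\exists t\in R_{sd}[q]$ with $t>s$ and $\forall a\in A(t):+\partial a\in P(1..i)$; ($-\partial$)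 if $P(i+1)=-\partial q$ then $-\Delta q\in P(1..i)$ and either $\forall r\in R_{sd}[q]\,\exists a\in A(r):-\partial a\in P(1..i)$, or $+\Delta\sim q\in P(1..i)$, or $\exists s\in R[\sim q]$ with $\forall a\in A(s):+\partial a\in P(1..i)$ and for every $t\in R_{sd}[q]$ either $\exists a\in A(t):-\partial a\in P(1..i)$ or $t\not> s$. $D\vdash L$ means $L$ occurs in some derivation in $D$. A literal $q$ is strictly unknowable in $D$ iff $D\not\vdash+\Delta q$ and $D\not\vdash-\Delta q$; defeasibly unknowable iff $D\not\vdash+\partial q$ and $D\not\vdash-\partial q$; unknowable iff it is strictly or defeasibly unknowable. The dependency graph $DG(D)$ has points $\{q,\sim q\}$ for literals $q$ in $D$ and an arc from $\{b,\sim b\}$ to $\{a,\sim a\}$ whenever some rule $r\in R[b]$ has $a\in A(r)$. $U(D)$ is the subgraph of $DG(D)$ induced on the points $\{q,\sim q\}$ such that $q$ is unknowable in $D$. -}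

module Defs where

open import Data.Nat using (ℕ)
open import Data.Fin using (Fin)
open import Data.Bool using (Bool; true)
open import Data.List using (List; _∷_)
open import Data.List.Membership.Propositional using (_∈_; _∉_)
open import Data.List.Relation.Unary.All using (All)
open import Data.List.Relation.Unary.Any using (Any)
open import Data.Product using (Σ; ∃; _×_)
open import Data.Sum using (_⊎_)
open import Relation.Nullary using (¬_)
open import Relation.Binary.PropositionalEquality using (_≡_)
open import Relation.Binary.Construct.Closure.Transitive using (TransClosure)

data Literal : Set where
  pos : ℕ → Literal
  neg : ℕ → Literal

∼_ : Literal → Literal
∼ pos p = neg p
∼ neg p = pos p

data Kind : Set where
  strict defeasible defeater : Kind

record Rule : Set where
  constructor mkRule
  field
    kind : Kind
    ante : List Literal
    head : Literal

open Rule public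

data IsSD : Kind → Set where
  sd-strict     : IsSD strict
  sd-defeasible : IsSD defeasible

-- The rules are indexed by Fin nR: the index is the (unique) label of the rule.

record Theory : Set where
  field
    facts : List Literal
    nR    : ℕ
    rule  : Fin nR → Rule
    sup   : Fin nR → Fin nR → Bool

  _≻_ : Fin nR → Fin nR → Set
  t ≻ s = sup t s ≡ true

  field
    acyclic : ∀ r → ¬ TransClosure _≻_ r r

open Theory public

data Tag : Set where
  +Δ -Δ +∂ -∂ : Tag

record Tagged : Set where
  constructor _∶_
  field
    tag : Tag
    lit : Literal

module _ (D : Theory) where

  private
    R = Fin (nR D)
    A : R → List Literal
    A r = ante (rule D r)
    C : R → Literal
    C r = head (rule D r)
    K : R → Kind
    K r = kind (rule D r)

  -- Cond P x : the tagged literal x may be appended to a derivation whose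
  -- earlier entries are (the elements of) P.
  Cond : List Tagged → Tagged → Set
  Cond P (+Δ ∶ q) =
    q ∈ facts D ⊎
    Σ R λ r → K r ≡ strict × C r ≡ q × All (λ a → (+Δ ∶ a) ∈ P) (A r)
  Cond P (-Δ ∶ q) =
    q ∉ facts D ×
    (∀ (r : R) → K r ≡ strict → C r ≡ q → Any (λ a → (-Δ ∶ a) ∈ P) (A r))
  Cond P (+∂ ∶ q) =
    (+Δ ∶ q) ∈ P ⊎
    ( (Σ R λ r → IsSD (K r) × C r ≡ q × All (λ a → (+∂ ∶ a) ∈ P) (A r))
    × (-Δ ∶ (∼ q)) ∈ P
    × (∀ (s : R) → C s ≡ ∼ q →
         Any (λ a → (-∂ ∶ a) ∈ P) (A s) ⊎
         (Σ R λ t → IsSD (K t) × C t ≡ q × _≻_ D t s × All (λ a → (+∂ ∶ a) ∈ P) (A t))))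
  Cond P (-∂ ∶ q) =
    (-Δ ∶ q) ∈ P ×
    ( (∀ (r : R) → IsSD (K r) → C r ≡ q → Any (λ a → (-∂ ∶ a) ∈ P) (A r))
    ⊎ (+Δ ∶ (∼ q)) ∈ P
    ⊎ (Σ R λ s → C s ≡ ∼ q × All (λ a → (+∂ ∶ a) ∈ P) (A s) ×
         (∀ (t : R) → IsSD (K t) → C t ≡ q →
            Any (λ a → (-∂ ∶ a) ∈ P) (A t) ⊎ ¬ (_≻_ D t s))))

  -- A derivation, stored in REVERSE order (most recent entry first):
  -- the list  x ∷ P  is a derivation iff P is and x satisfies Cond w.r.t. P.
  data Derivation : List Tagged → Set where
    []  : Derivation Data.List.[]
    _∷_ : ∀ {P x} → Cond P x → Derivation P → Derivation (x ∷ P)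

  _⊢_ : Tagged → Set
  _⊢_ L = Σ (List Tagged) λ P → Derivation P × L ∈ P

  StrictlyUnknowable DefeasiblyUnknowable Unknowable : Literal → Set
  StrictlyUnknowable q = ¬ _⊢_ (+Δ ∶ q) × ¬ _⊢_ (-Δ ∶ q)
  DefeasiblyUnknowable q = ¬ _⊢_ (+∂ ∶ q) × ¬ _⊢_ (-∂ ∶ q)
  Unknowable q = StrictlyUnknowable q ⊎ DefeasiblyUnknowable q

  -- Dependency graph. A point {q, ∼q} is represented by either literal q.

  LitInD : Literal → Set
  LitInD q = q ∈ facts D ⊎ (Σ R λ r → C r ≡ q ⊎ q ∈ A r)

  PointDG : Literal → Set
  PointDG q = LitInD q ⊎ LitInD (∼ q)

  Arc : Literal → Literal → Set
  Arc b a = Σ R λ r → (C r ≡ b ⊎ C r ≡ ∼ b) × (a ∈ A r ⊎ (∼ a) ∈ A r)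

  PointU : Literal → Set
  PointU q = PointDG q × (Unknowable q ⊎ Unknowable (∼ q))

  OutDegPosU : Literal → Set
  OutDegPosU q = Σ Literal λ a → PointU a × Arc q a

{-# OPTIONS --safe #-}
-- Constructively, an unknowable antecedent has to be exhibited, so derivability must be
-- decided. Fix a finite set U of literals, closed under complement, containing every
-- antecedent. Extending the empty derivation by applicable tagged literals over U until none
-- is left yields a derivation that contains every derivable tagged literal over U. In it, a
-- literal b ∈ U whose rules for b and ∼b have only settled antecedents is itself settled:
-- once those antecedents are settled, the failure of the +Δ (+∂) condition for b forces the
-- -Δ (-∂) condition. So if b is unknowable, some rule for b or ∼b has an unknowable
-- antecedent a, and {a, ∼a} is the required successor of {b, ∼b} in U(D).
module Submission where

open import Defs

open import Data.Bool using (true; _≟_)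
open import Data.Fin using (Fin; zero; suc)
import Data.Fin.Properties as Fin
open import Data.List
  using (List; []; _∷_; _++_; map; concatMap; filter; length; allFin; cartesianProductWith)
open import Data.List.Membership.Propositional using (_∈_; _∉_; find; lose)
open import Data.List.Membership.Propositional.Properties
  using (∈-map⁺; ∈-map⁻; ∈-++⁺ˡ; ∈-++⁺ʳ; ∈-++⁻; ∈-concatMap⁺; ∈-allFin; ∈-filter⁺; ∈-filter⁻;
         ∈-cartesianProductWith⁺)
open import Data.List.Relation.Binary.Pointwise using (Pointwise-≡⇒≡)
open import Data.List.Relation.Binary.Sublist.Heterogeneous.Properties
  using (length-mono-≤; toPointwise; ⊆-filter-Sublist)
open import Data.List.Relation.Binary.Sublist.Propositional using (_⊆_; ⊆-refl)
open import Data.List.Relation.Unary.All as All using (All; []; _∷_)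
open import Data.List.Relation.Unary.All.Properties using (¬Any⇒All¬)
open import Data.List.Relation.Unary.Any as Any using (Any; here; there)
import Data.Nat as ℕ
open import Data.Nat.Induction using (<-wellFounded)
open import Data.Nat.Properties using (≤∧≢⇒<)
open import Data.Product using (Σ; ∃; _×_; _,_; proj₁; proj₂)
open import Data.Sum using (_⊎_; inj₁; inj₂; [_,_]; fromInj₁; fromInj₂)
import Data.Sum as Sum
open import Function using (_∘_)
open import Induction.WellFounded using (Acc; acc)
open import Relation.Binary.Definitions using (DecidableEquality)
open import Relation.Binary.PropositionalEquality using (_≡_; refl; sym; trans; subst; cong; cong₂)
open import Relation.Nullary using (¬_; Dec; yes; no; contradiction)
open import Relation.Nullary.Decidable
  using (_×-dec_; _⊎-dec_; _→-dec_; ¬?; map′; decidable-stable; toSum)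

open Tagged using (lit)

⊆-length-< : ∀ {A : Set} {x : A} {xs ys} → xs ⊆ ys → x ∈ ys → x ∉ xs → length xs ℕ.< length ys
⊆-length-< xs⊆ys x∈ys x∉xs = ≤∧≢⇒< (length-mono-≤ xs⊆ys) λ same-length →
  x∉xs (subst (_ ∈_) (sym (Pointwise-≡⇒≡ (toPointwise same-length xs⊆ys))) x∈ys)

All⊎⇒All⊎Any : ∀ {A : Set} {P Q : A → Set} {xs} →
  All (λ x → P x ⊎ Q x) xs → All P xs ⊎ Any Q xs
All⊎⇒All⊎Any [] = inj₁ []
All⊎⇒All⊎Any (inj₁ p ∷ rest) = [ inj₁ ∘ (p ∷_) , inj₂ ∘ there ] (All⊎⇒All⊎Any rest)
All⊎⇒All⊎Any (inj₂ q ∷ _) = inj₂ (here q)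

module Saturation
  {X : Set} (_≟ˣ_ : DecidableEquality X) (candidates : List X)
  (Step : List X → X → Set) (step? : ∀ P x → Dec (Step P x))
  (Chain : List X → Set) (extend : ∀ {P x} → Step P x → Chain P → Chain (x ∷ P))
  where

  open import Data.List.Membership.DecPropositional _≟ˣ_ using (_∈?_; _∉?_)

  Closed : List X → Set
  Closed P = ∀ {x} → x ∈ candidates → Step P x → x ∈ P

  missing : List X → List X
  missing P = filter (_∉? P) candidates

  missing-shrinks : ∀ {x P} → x ∈ candidates → x ∉ P →
    length (missing (x ∷ P)) ℕ.< length (missing P)
  missing-shrinks {x} {P} x∈ x∉P = ⊆-length-< shrunk (∈-filter⁺ (_∉? P) x∈ x∉P) x∉missing
    where
    shrunk : missing (x ∷ P) ⊆ missing P
    shrunk = ⊆-filter-Sublist (_∉? (x ∷ P)) (_∉? P) (λ { refl y∉xP → y∉xP ∘ there })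
                              (⊆-refl {x = candidates})
    x∉missing : x ∉ missing (x ∷ P)
    x∉missing x∈missing = proj₂ (∈-filter⁻ (_∉? (x ∷ P)) {xs = candidates} x∈missing) (here refl)

  saturate-from : ∀ P → Acc ℕ._<_ (length (missing P)) → Chain P → ∃ λ P′ → Chain P′ × Closed P′
  saturate-from P (acc shrink) chain with Any.any? (λ x → x ∉? P ×-dec step? P x) candidates
  ... | yes fresh = let x , x∈ , x∉P , step = find fresh in
    saturate-from (x ∷ P) (shrink (missing-shrinks x∈ x∉P)) (extend step chain)
  ... | no none = P , chain , λ x∈ step →
    decidable-stable (_ ∈? P) (λ x∉P → none (lose x∈ (x∉P , step)))

  saturate : Chain [] → ∃ λ P → Chain P × Closed P
  saturate = saturate-from [] (<-wellFounded _)

∼-involutive : ∀ a → ∼ (∼ a) ≡ a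
∼-involutive (pos p) = refl
∼-involutive (neg p) = refl

_≟ᴸ_ : DecidableEquality Literal
pos m ≟ᴸ pos n = map′ (cong pos) (λ { refl → refl }) (m ℕ.≟ n)
pos m ≟ᴸ neg n = no λ ()
neg m ≟ᴸ pos n = no λ ()
neg m ≟ᴸ neg n = map′ (cong neg) (λ { refl → refl }) (m ℕ.≟ n)

withComplements : List Literal → List Literal
withComplements ls = ls ++ map ∼_ ls

withComplements-∼-closed : ∀ {ls a} → a ∈ withComplements ls → ∼ a ∈ withComplements ls
withComplements-∼-closed {ls} a∈ with ∈-++⁻ ls a∈
... | inj₁ a∈ls = ∈-++⁺ʳ ls (∈-map⁺ ∼_ a∈ls)
... | inj₂ a∈∼ls with b , b∈ls , refl ← ∈-map⁻ ∼_ a∈∼ls =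
  ∈-++⁺ˡ (subst (_∈ ls) (sym (∼-involutive b)) b∈ls)

tagIndex : Tag → Fin 4
tagIndex +Δ = zero
tagIndex -Δ = suc zero
tagIndex +∂ = suc (suc zero)
tagIndex -∂ = suc (suc (suc zero))

indexTag : Fin 4 → Tag
indexTag zero = +Δ
indexTag (suc zero) = -Δ
indexTag (suc (suc zero)) = +∂
indexTag (suc (suc (suc zero))) = -∂

indexTag-tagIndex : ∀ t → indexTag (tagIndex t) ≡ t
indexTag-tagIndex +Δ = refl
indexTag-tagIndex -Δ = refl
indexTag-tagIndex +∂ = refl
indexTag-tagIndex -∂ = refl

tagIndex-injective : ∀ {s t} → tagIndex s ≡ tagIndex t → s ≡ t
tagIndex-injective {s} {t} eq =
  trans (sym (indexTag-tagIndex s)) (trans (cong indexTag eq) (indexTag-tagIndex t))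

tags : List Tag
tags = map indexTag (allFin 4)

∈-tags : ∀ t → t ∈ tags
∈-tags t = subst (_∈ tags) (indexTag-tagIndex t) (∈-map⁺ indexTag (∈-allFin (tagIndex t)))

_≟ᵀ_ : DecidableEquality Tag
s ≟ᵀ t = map′ tagIndex-injective (cong tagIndex) (tagIndex s Fin.≟ tagIndex t)

_≟ᵀᴸ_ : DecidableEquality Tagged
(s ∶ a) ≟ᵀᴸ (t ∶ b) =
  map′ (λ (s≡t , a≡b) → cong₂ _∶_ s≡t a≡b) (λ { refl → refl , refl }) (s ≟ᵀ t ×-dec a ≟ᴸ b)

open import Data.List.Membership.DecPropositional _≟ᴸ_ using () renaming (_∈?_ to _∈ᴸ?_)
open import Data.List.Membership.DecPropositional _≟ᵀᴸ_ using (_∈?_)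

strict? : (k : Kind) → Dec (k ≡ strict)
strict? strict = yes refl
strict? defeasible = no λ ()
strict? defeater = no λ ()

isSD? : (k : Kind) → Dec (IsSD k)
isSD? strict = yes sd-strict
isSD? defeasible = yes sd-defeasible
isSD? defeater = no λ ()

StrictlySettled DefeasiblySettled Unsettled : List Tagged → Literal → Set
StrictlySettled P a = (+Δ ∶ a) ∈ P ⊎ (-Δ ∶ a) ∈ P
DefeasiblySettled P a = (+∂ ∶ a) ∈ P ⊎ (-∂ ∶ a) ∈ P
Unsettled P a = ¬ StrictlySettled P a ⊎ ¬ DefeasiblySettled P a

strictlySettled? : ∀ P a → Dec (StrictlySettled P a)
strictlySettled? P a = (+Δ ∶ a) ∈? P ⊎-dec (-Δ ∶ a) ∈? P

defeasiblySettled? : ∀ P a → Dec (DefeasiblySettled P a)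
defeasiblySettled? P a = (+∂ ∶ a) ∈? P ⊎-dec (-∂ ∶ a) ∈? P

unsettled? : ∀ P a → Dec (Unsettled P a)
unsettled? P a = ¬? (strictlySettled? P a) ⊎-dec ¬? (defeasiblySettled? P a)

¬unsettled⇒settled : ∀ {P a} → ¬ Unsettled P a → StrictlySettled P a × DefeasiblySettled P a
¬unsettled⇒settled {P} {a} ¬unsettled =
  decidable-stable (strictlySettled? P a) (¬unsettled ∘ inj₁) ,
  decidable-stable (defeasiblySettled? P a) (¬unsettled ∘ inj₂)

module _ (D : Theory) where

  private
    R = Fin (nR D)
    A : R → List Literal
    A r = ante (rule D r)
    C : R → Literal
    C r = head (rule D r)
    K : R → Kind
    K r = kind (rule D r)

    AllIn AnyIn : Tag → List Tagged → List Literal → Set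
    AllIn t P = All (λ a → (t ∶ a) ∈ P)
    AnyIn t P = Any (λ a → (t ∶ a) ∈ P)

    allIn? : ∀ t P as → Dec (AllIn t P as)
    allIn? t P = All.all? (λ a → (t ∶ a) ∈? P)

    anyIn? : ∀ t P as → Dec (AnyIn t P as)
    anyIn? t P = Any.any? (λ a → (t ∶ a) ∈? P)

    _≻?_ : ∀ t s → Dec (_≻_ D t s)
    t ≻? s = sup D t s ≟ true

  Supported : List Tagged → Literal → Set
  Supported P q = Σ R λ r → IsSD (K r) × C r ≡ q × AllIn +∂ P (A r)

  Countered : List Tagged → Literal → R → Set
  Countered P q s =
    AnyIn -∂ P (A s) ⊎ Σ R λ t → IsSD (K t) × C t ≡ q × _≻_ D t s × AllIn +∂ P (A t)

  supported? : ∀ P q → Dec (Supported P q)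
  supported? P q = Fin.any? λ r → isSD? (K r) ×-dec C r ≟ᴸ q ×-dec allIn? +∂ P (A r)

  countered? : ∀ P q s → Dec (Countered P q s)
  countered? P q s = anyIn? -∂ P (A s) ⊎-dec
    Fin.any? λ t → isSD? (K t) ×-dec C t ≟ᴸ q ×-dec t ≻? s ×-dec allIn? +∂ P (A t)

  Cond? : ∀ P x → Dec (Cond D P x)
  Cond? P (+Δ ∶ q) =
    q ∈ᴸ? facts D ⊎-dec Fin.any? λ r → strict? (K r) ×-dec C r ≟ᴸ q ×-dec allIn? +Δ P (A r)
  Cond? P (-Δ ∶ q) =
    ¬? (q ∈ᴸ? facts D) ×-dec Fin.all? λ r → strict? (K r) →-dec C r ≟ᴸ q →-dec anyIn? -Δ P (A r)
  Cond? P (+∂ ∶ q) =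
    (+Δ ∶ q) ∈? P ⊎-dec
    supported? P q ×-dec (-Δ ∶ (∼ q)) ∈? P ×-dec
    Fin.all? λ s → C s ≟ᴸ (∼ q) →-dec countered? P q s
  Cond? P (-∂ ∶ q) =
    (-Δ ∶ q) ∈? P ×-dec
    ( (Fin.all? λ r → isSD? (K r) →-dec C r ≟ᴸ q →-dec anyIn? -∂ P (A r)) ⊎-dec
      (+Δ ∶ (∼ q)) ∈? P ⊎-dec
      (Fin.any? λ s → C s ≟ᴸ (∼ q) ×-dec allIn? +∂ P (A s) ×-dec
        Fin.all? λ t → isSD? (K t) →-dec C t ≟ᴸ q →-dec (anyIn? -∂ P (A t) ⊎-dec ¬? (t ≻? s))))

  -Δ-applicable : ∀ {P b} → ¬ Cond D P (+Δ ∶ b) →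
    (∀ r → K r ≡ strict → C r ≡ b → All (StrictlySettled P) (A r)) → Cond D P (-Δ ∶ b)
  -Δ-applicable ¬+Δ premises = ¬+Δ ∘ inj₁ , λ r k≡strict c →
    fromInj₂ (λ all+Δ → contradiction (inj₂ (r , k≡strict , c , all+Δ)) ¬+Δ)
             (All⊎⇒All⊎Any (premises r k≡strict c))

  -∂-applicable : ∀ {P q} → ¬ Cond D P (+∂ ∶ q) → StrictlySettled P q → StrictlySettled P (∼ q) →
    (∀ r → C r ≡ q ⊎ C r ≡ ∼ q → All (DefeasiblySettled P) (A r)) → Cond D P (-∂ ∶ q)
  -∂-applicable ¬+∂ (inj₁ +Δq) _ _ = contradiction (inj₁ +Δq) ¬+∂
  -∂-applicable ¬+∂ (inj₂ -Δq) (inj₁ +Δ∼q) _ = -Δq , inj₂ (inj₁ +Δ∼q)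
  -∂-applicable {P} {q} ¬+∂ (inj₂ -Δq) (inj₂ -Δ∼q) premises with supported? P q
  ... | no unsupported = -Δq , inj₁ λ r sd c →
    fromInj₂ (λ all+∂ → contradiction (r , sd , c , all+∂) unsupported)
             (All⊎⇒All⊎Any (premises r (inj₁ c)))
  ... | yes supported
    with s , ¬countered-attack ← Fin.¬∀⟶∃¬ _ _ (λ s → C s ≟ᴸ (∼ q) →-dec countered? P q s)
                                   (λ countered → ¬+∂ (inj₂ (supported , -Δ∼q , countered)))
    = -Δq , inj₂ (inj₂ (s , attacks , all+∂ , beaten))
    where
    attacks : C s ≡ ∼ q
    attacks = decidable-stable (C s ≟ᴸ (∼ q))
      (λ ¬attacks → ¬countered-attack (λ attacks → contradiction attacks ¬attacks))
    ¬countered : ¬ Countered P q s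
    ¬countered countered = ¬countered-attack (λ _ → countered)
    all+∂ : AllIn +∂ P (A s)
    all+∂ = fromInj₁ (λ any-∂ → contradiction (inj₁ any-∂) ¬countered)
                     (All⊎⇒All⊎Any (premises s (inj₂ attacks)))
    beaten : ∀ t → IsSD (K t) → C t ≡ q → AnyIn -∂ P (A t) ⊎ ¬ _≻_ D t s
    beaten t sd c with t ≻? s
    ... | no t⊁s = inj₂ t⊁s
    ... | yes t≻s = inj₁ (fromInj₂
      (λ all+∂ → contradiction (inj₂ (t , sd , c , t≻s , all+∂)) ¬countered)
      (All⊎⇒All⊎Any (premises t (inj₁ c))))

  settled⇒¬unknowable : ∀ {P a} → Derivation D P →
    StrictlySettled P a × DefeasiblySettled P a → ¬ Unknowable D a
  settled⇒¬unknowable {P} derivation (strictly , defeasibly) =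
    [ (λ (¬+Δ , ¬-Δ) → [ ¬+Δ ∘ derived , ¬-Δ ∘ derived ] strictly)
    , (λ (¬+∂ , ¬-∂) → [ ¬+∂ ∘ derived , ¬-∂ ∘ derived ] defeasibly) ]
    where
    derived : ∀ {x} → x ∈ P → D ⊢ x
    derived x∈P = P , derivation , x∈P

  arc-to-unknowable : ∀ {a b} r → C r ≡ b ⊎ C r ≡ ∼ b → a ∈ A r → Unknowable D a → OutDegPosU D b
  arc-to-unknowable r heads a∈ unknown =
    _ , (inj₁ (inj₂ (r , inj₂ a∈)) , inj₁ unknown) , r , heads , inj₁ a∈

  outDegPos-∼ : ∀ {q} → OutDegPosU D (∼ q) → OutDegPosU D q
  outDegPos-∼ {q} (a , a∈U , r , heads , a∈) =
    a , a∈U , r , [ inj₂ , inj₁ ∘ (λ c → trans c (∼-involutive q)) ] heads , a∈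

  -- Every literal not occurring in D has derivable -Δ and -∂, so no finite derivation contains all
  -- derivable tagged literals; U is a finite stand-in, and the condition for a tagged literal
  -- over U only inspects tagged literals over U.
  module Closure
    (U : List Literal) (∼-closed : ∀ {a} → a ∈ U → ∼ a ∈ U)
    (antecedents⊆U : ∀ {r a} → a ∈ A r → a ∈ U)
    where

    candidates : List Tagged
    candidates = cartesianProductWith _∶_ tags U

    ∈-candidates : ∀ {x} → lit x ∈ U → x ∈ candidates
    ∈-candidates {t ∶ a} = ∈-cartesianProductWith⁺ _∶_ (∈-tags t)

    _⊆ᵁ_ : List Tagged → List Tagged → Set
    P ⊆ᵁ P′ = ∀ {x} → lit x ∈ U → x ∈ P → x ∈ P′

    module _ {P P′} (P⊆P′ : P ⊆ᵁ P′) where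

      AllIn-mono : ∀ {t} r → AllIn t P (A r) → AllIn t P′ (A r)
      AllIn-mono r all = All.tabulate λ a∈ → P⊆P′ (antecedents⊆U a∈) (All.lookup all a∈)

      AnyIn-mono : ∀ {t} r → AnyIn t P (A r) → AnyIn t P′ (A r)
      AnyIn-mono r any = let _ , a∈ , a∈P = find any in lose a∈ (P⊆P′ (antecedents⊆U a∈) a∈P)

      Countered-mono : ∀ {q} s → Countered P q s → Countered P′ q s
      Countered-mono s = Sum.map (AnyIn-mono s)
        λ (t , sd , c , t≻s , all) → t , sd , c , t≻s , AllIn-mono t all

      Cond-mono : ∀ {x} → lit x ∈ U → Cond D P x → Cond D P′ x
      Cond-mono {+Δ ∶ q} _ (inj₁ fact) = inj₁ fact
      Cond-mono {+Δ ∶ q} _ (inj₂ (r , k≡strict , c , all)) =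
        inj₂ (r , k≡strict , c , AllIn-mono r all)
      Cond-mono { -Δ ∶ q} _ (¬fact , blocked) =
        ¬fact , λ r k≡strict c → AnyIn-mono r (blocked r k≡strict c)
      Cond-mono {+∂ ∶ q} q∈U (inj₁ +Δq) = inj₁ (P⊆P′ q∈U +Δq)
      Cond-mono {+∂ ∶ q} q∈U (inj₂ ((r , sd , c , all) , -Δ∼q , countered)) =
        inj₂ ( (r , sd , c , AllIn-mono r all) , P⊆P′ (∼-closed q∈U) -Δ∼q
             , λ s c → Countered-mono s (countered s c))
      Cond-mono { -∂ ∶ q} q∈U (-Δq , inj₁ blocked) =
        P⊆P′ q∈U -Δq , inj₁ λ r sd c → AnyIn-mono r (blocked r sd c)
      Cond-mono { -∂ ∶ q} q∈U (-Δq , inj₂ (inj₁ +Δ∼q)) =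
        P⊆P′ q∈U -Δq , inj₂ (inj₁ (P⊆P′ (∼-closed q∈U) +Δ∼q))
      Cond-mono { -∂ ∶ q} q∈U (-Δq , inj₂ (inj₂ (s , c , all , beaten))) =
        P⊆P′ q∈U -Δq , inj₂ (inj₂ ( s , c , AllIn-mono s all
                                   , λ t sd c → Sum.map₁ (AnyIn-mono t) (beaten t sd c)))

    open Saturation _≟ᵀᴸ_ candidates (Cond D) Cond? (Derivation D) _∷_ using (Closed; saturate)

    module _ {P} (closed : Closed P) where

      derivation-⊆ᵁ : ∀ {Q} → Derivation D Q → Q ⊆ᵁ P
      derivation-⊆ᵁ (cond ∷ derivation) x∈U (here refl) =
        closed (∈-candidates x∈U) (Cond-mono (derivation-⊆ᵁ derivation) x∈U cond)
      derivation-⊆ᵁ (_ ∷ derivation) x∈U (there x∈Q) = derivation-⊆ᵁ derivation x∈U x∈Q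

      derivable⇒∈ : ∀ {x} → lit x ∈ U → D ⊢ x → x ∈ P
      derivable⇒∈ x∈U (_ , derivation , x∈Q) = derivation-⊆ᵁ derivation x∈U x∈Q

      unsettled⇒unknowable : ∀ {a} → a ∈ U → Unsettled P a → Unknowable D a
      unsettled⇒unknowable a∈U = Sum.map
        (λ ¬settled → ¬settled ∘ inj₁ ∘ derivable⇒∈ a∈U , ¬settled ∘ inj₂ ∘ derivable⇒∈ a∈U)
        (λ ¬settled → ¬settled ∘ inj₁ ∘ derivable⇒∈ a∈U , ¬settled ∘ inj₂ ∘ derivable⇒∈ a∈U)

      settle : ∀ {s t a} → a ∈ U → (¬ Cond D P (s ∶ a) → Cond D P (t ∶ a)) →
        (s ∶ a) ∈ P ⊎ (t ∶ a) ∈ P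
      settle a∈U refute =
        Sum.map (closed (∈-candidates a∈U)) (closed (∈-candidates a∈U) ∘ refute) (toSum (Cond? P _))

      settled-by-premises : ∀ {b} → b ∈ U →
        (∀ r → C r ≡ b ⊎ C r ≡ ∼ b → All (λ a → StrictlySettled P a × DefeasiblySettled P a) (A r)) →
        StrictlySettled P b × DefeasiblySettled P b
      settled-by-premises {b} b∈U premises = b-strictly , b-defeasibly
        where
        b-strictly : StrictlySettled P b
        b-strictly = settle b∈U λ ¬+Δ →
          -Δ-applicable ¬+Δ λ r _ c → All.map proj₁ (premises r (inj₁ c))
        ∼b-strictly : StrictlySettled P (∼ b)
        ∼b-strictly = settle (∼-closed b∈U) λ ¬+Δ →
          -Δ-applicable ¬+Δ λ r _ c → All.map proj₁ (premises r (inj₂ c))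
        b-defeasibly : DefeasiblySettled P b
        b-defeasibly = settle b∈U λ ¬+∂ →
          -∂-applicable ¬+∂ b-strictly ∼b-strictly λ r c → All.map proj₂ (premises r c)

    unknowable⇒outDegPos : ∀ {b} → b ∈ U → Unknowable D b → OutDegPosU D b
    unknowable⇒outDegPos {b} b∈U unknown
      with P , derivation , closed ← saturate []
      with Fin.any? (λ r → (C r ≟ᴸ b ⊎-dec C r ≟ᴸ (∼ b)) ×-dec Any.any? (unsettled? P) (A r))
    ... | yes (r , heads , unsettled-premise) =
      let _ , a∈ , unsettled-a = find unsettled-premise in
      arc-to-unknowable r heads a∈ (unsettled⇒unknowable closed (antecedents⊆U a∈) unsettled-a)
    ... | no none = contradiction unknown (settled⇒¬unknowable derivation
      (settled-by-premises closed b∈U λ r heads → All.map ¬unsettled⇒settled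
        (¬Any⇒All¬ (A r) λ unsettled-premise → none (r , heads , unsettled-premise))))

  unknowable⇒outDegPos : ∀ {b} → Unknowable D b → OutDegPosU D b
  unknowable⇒outDegPos {b} =
    Closure.unknowable⇒outDegPos
      U (withComplements-∼-closed {b ∷ antecedents}) antecedent∈U (here refl)
    where
    antecedents : List Literal
    antecedents = concatMap A (allFin (nR D))
    U : List Literal
    U = withComplements (b ∷ antecedents)
    antecedent∈U : ∀ {r a} → a ∈ A r → a ∈ U
    antecedent∈U {r} a∈ = there (∈-++⁺ˡ (∈-concatMap⁺ A (lose (∈-allFin r) a∈)))

lemma2p1 : (D : Theory) → (q : Literal) → PointU D q → OutDegPosU D q
lemma2p1 D q (_ , inj₁ q-unknowable) = unknowable⇒outDegPos D q-unknowable
lemma2p1 D q (_ , inj₂ ∼q-unknowable) = outDegPos-∼ D (unknowable⇒outDegPos D ∼q-unknowable)
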